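{- Let $G$ be a finite group, $m\ge3$ an integer, $R,L,T$ Cayley subsets of $G$, $S\subseteq G$ with $|R|=|L|=|T|-|S|+1$, and $x\in G\setminus S$. Let $\Theta:=\Theta^m(G,R,L,S,T,x)$ be the graph defined below. Suppose that (1) $\mathrm{BiCay}(G,R,L,S)$ is a $2$-GRR, and (2) for each $i\in\{2,\dots,m-1\}$, the subgraph induced by $\Theta$ on the neighbourhood of $1_0$ is not isomorphic to the subgraph induced on the neighbourhood of $1_i$, and the subgraph induced on the neighbourhood of $1_1$ is not isomorphic to the subgraph induced on the neighbourhood of $1_i$. Then $\Theta$ is an $m$-GRR for $G$.
   Context: A Cayley subset is $X\subseteq G$ with $1\notin X$ and $X=X^{ -1}$. Write $g_i$ for $(g,i)\in G\times\{0,\dots,m-1\}$. $\Theta^m(G,R,L,S,T,x)$ is the graph with vertex set $G\times\{0,\dots,m-1\}$ and edges: $\{g_0,(rg)_0\}$ ($g\in G,r\in R$); $\{g_1,(lg)_1\}$ ($l\in L$); $\{g_0,(sg)_1\}$ ($s\in S$); $\{g_i,(tg)_i\}$ for $i\in\{2,\dots,m-1\}$, $t\in T$; $\{g_i,g_{i+1}\}$ for $i\in\{1,\dots,m-2\}$; and $\{g_0,(xg)_{m-1}\}$, all $g\in G$. It is regular of valency $|T|+2$. $\mathrm{BiCay}(G,R,L,S)$ is the graph with vertex set $G\times\{0,1\}$ and edges $\{g_0,(rg)_0\}$, $\{g_1,(lg)_1\}$, $\{g_0,(sg)_1\}$ ($g\in G$, $r\in R$, $l\in L$, $s\in S$). An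 $m$-GRR of $G$ is a regular finite simple graph whose automorphism group is isomorphic to $G$ and acts semiregularly (trivial stabilizers) on the vertices with exactly $m$ orbits. -}

module Defs where

open import Level using (0ℓ)
open import Data.Nat using (ℕ; zero; suc; _+_; _≤_; _<_; z≤n; s≤s)
open import Data.Nat.Properties using (≤-trans)
open import Data.Fin using (Fin; toℕ; fromℕ<)
open import Data.Product using (Σ; ∃; _×_; _,_; proj₁; proj₂)
open import Data.Sum using (_⊎_)
open import Data.Empty using (⊥)
open import Data.Irrelevant using (Irrelevant)
open import Relation.Nullary using (¬_)
open import Relation.Unary using (Pred; _∈_)
open import Relation.Binary.PropositionalEquality using (_≡_)
open import Function.Bundles using (_↔_; _⇔_; Inverse)
open import Algebra.Structures using (IsGroup)

record FiniteGroup : Set₁ where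
  field
    Carrier : Set
    _∙_     : Carrier → Carrier → Carrier
    ε       : Carrier
    _⁻¹     : Carrier → Carrier
    isGroup : IsGroup _≡_ _∙_ ε _⁻¹
    order   : ℕ
    enum    : Fin order ↔ Carrier

_HasSize_ : Set → ℕ → Set
A HasSize k = Fin k ↔ A

-- Cardinality of a subset (a predicate) of a type: the proof of membership
-- is made irrelevant so that each element is counted once.
Elems : {A : Set} → Pred A 0ℓ → Set
Elems {A} P = Σ A (λ a → Irrelevant (P a))

module _ (G : FiniteGroup) where
  open FiniteGroup G

  IsCayleySubset : Pred Carrier 0ℓ → Set
  IsCayleySubset X = ¬ (ε ∈ X) × (∀ g → g ∈ X → (g ⁻¹) ∈ X)

record Graph : Set₁ where
  field
    V   : Set
    Adj : V → V → Set
open Graph public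

IsFinite : Graph → Set
IsFinite Γ = ∃ λ N → V Γ HasSize N

IsSimple : Graph → Set
IsSimple Γ = (∀ u v → Adj Γ u v → Adj Γ v u) × (∀ v → ¬ Adj Γ v v)

Nbhd : (Γ : Graph) → V Γ → Set
Nbhd Γ v = Elems (Adj Γ v)

IsRegular : Graph → Set
IsRegular Γ = ∃ λ k → ∀ v → Nbhd Γ v HasSize k

InducedNbhd : (Γ : Graph) → V Γ → Graph
InducedNbhd Γ v = record { V = Nbhd Γ v ; Adj = λ a b → Adj Γ (proj₁ a) (proj₁ b) }

record _≅_ (Γ Δ : Graph) : Set where
  field
    bij  : V Γ ↔ V Δ
    pres : ∀ u v → Adj Γ u v ⇔ Adj Δ (Inverse.to bij u) (Inverse.to bij v)

Aut : Graph → Set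
Aut Γ = Γ ≅ Γ

app : {Γ : Graph} → Aut Γ → V Γ → V Γ
app σ = Inverse.to (_≅_.bij σ)

-- Automorphisms are identified when they agree pointwise; Aut is a group
-- under composition.
record IsGRR (m : ℕ) (G : FiniteGroup) (Γ : Graph) : Set where
  open FiniteGroup G
  field
    finite  : IsFinite Γ
    simple  : IsSimple Γ
    regular : IsRegular Γ
    φ       : Carrier → Aut Γ
    φ-hom   : ∀ g h v → app (φ (g ∙ h)) v ≡ app (φ g) (app (φ h) v)
    φ-inj   : ∀ g h → (∀ v → app (φ g) v ≡ app (φ h) v) → g ≡ h
    φ-surj  : ∀ (σ : Aut Γ) → ∃ λ g → ∀ v → app (φ g) v ≡ app σ v
    semireg : ∀ (σ : Aut Γ) v → app σ v ≡ v → ∀ w → app σ w ≡ w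
    -- exactly m orbits: a surjective labelling of vertices whose fibres are the orbits
    orbit      : V Γ → Fin m
    orbit-surj : ∀ (i : Fin m) → ∃ λ v → orbit v ≡ i
    orbit-iff  : ∀ u v → (orbit u ≡ orbit v) ⇔ (∃ λ (σ : Aut Γ) → app σ u ≡ v)

module _ (G : FiniteGroup) where
  open FiniteGroup G

  -- directed generators of the edges of BiCay; adjacency is the symmetric closure
  data BiCayEdge (R L S : Pred Carrier 0ℓ) : Carrier × Fin 2 → Carrier × Fin 2 → Set where
    eR : ∀ g r → r ∈ R → BiCayEdge R L S (g , Fin.zero) (r ∙ g , Fin.zero)
    eL : ∀ g l → l ∈ L → BiCayEdge R L S (g , Fin.suc Fin.zero) (l ∙ g , Fin.suc Fin.zero)
    eS : ∀ g s → s ∈ S → BiCayEdge R L S (g , Fin.zero) (s ∙ g , Fin.suc Fin.zero)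

  BiCay : (R L S : Pred Carrier 0ℓ) → Graph
  BiCay R L S = record
    { V = Carrier × Fin 2
    ; Adj = λ u v → BiCayEdge R L S u v ⊎ BiCayEdge R L S v u }

  data ThetaEdge (m : ℕ) (R L S T : Pred Carrier 0ℓ) (x : Carrier)
       : Carrier × Fin m → Carrier × Fin m → Set where
    eR : ∀ g r (i : Fin m) → toℕ i ≡ 0 → r ∈ R → ThetaEdge m R L S T x (g , i) (r ∙ g , i)
    eL : ∀ g l (i : Fin m) → toℕ i ≡ 1 → l ∈ L → ThetaEdge m R L S T x (g , i) (l ∙ g , i)
    eS : ∀ g s (i j : Fin m) → toℕ i ≡ 0 → toℕ j ≡ 1 → s ∈ S
         → ThetaEdge m R L S T x (g , i) (s ∙ g , j)
    eT : ∀ g t (i : Fin m) → 2 ≤ toℕ i → t ∈ T → ThetaEdge m R L S T x (g , i) (t ∙ g , i)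
    eP : ∀ g (i j : Fin m) → 1 ≤ toℕ i → toℕ j ≡ suc (toℕ i)
         → ThetaEdge m R L S T x (g , i) (g , j)
    eX : ∀ g (i j : Fin m) → toℕ i ≡ 0 → suc (toℕ j) ≡ m
         → ThetaEdge m R L S T x (g , i) (x ∙ g , j)

  Theta : (m : ℕ) (R L S T : Pred Carrier 0ℓ) (x : Carrier) → Graph
  Theta m R L S T x = record
    { V = Carrier × Fin m
    ; Adj = λ u v → ThetaEdge m R L S T x u v ⊎ ThetaEdge m R L S T x v u }

fin0 : {m : ℕ} → 3 ≤ m → Fin m
fin0 h = fromℕ< {0} (≤-trans (s≤s z≤n) h)

fin1 : {m : ℕ} → 3 ≤ m → Fin m
fin1 h = fromℕ< {1} (≤-trans (s≤s (s≤s z≤n)) h)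

module Submission where

-- Write m = n + 3, so that the layers 2,…,m-1 are the indices suc (suc k)
-- with k : Fin (suc n).  The proof has three parts.
--
-- 1. Right multiplication g_i ↦ (gc)_i is an automorphism of Θ (all edges
--    are defined by left multiplication), so G acts with the layers as
--    orbits.
-- 2. Θ is finite and simple, and every neighbourhood is parametrised
--    explicitly: that of g_0 by R ⊎ S ⊎ {x}, that of g_1 by L ⊎ S ⊎ {g_2},
--    that of g_{k+2} by T ⊎ {down} ⊎ {up}.  The size hypotheses then make
--    Θ regular of valency |T| + 2.
-- 3. Every automorphism τ is a right multiplication.  By the hypothesis on
--    induced neighbourhoods τ keeps the layers {0,1} (which carry BiCay),
--    so it restricts to an automorphism of BiCay(G,R,L,S); as BiCay has two
--    orbits, τ keeps layer 0.  After composing with a right multiplication,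
--    τ fixes 1_0, hence (BiCay being semiregular) fixes layers 0 and 1
--    pointwise, and climbing the paths g_1 - g_2 - … - g_{m-1} it fixes
--    every vertex.

open import Defs
open import Level using (0ℓ)
open import Data.Nat as ℕ using (ℕ; zero; suc; _+_; _≤_; _<_; z≤n; s≤s)
import Data.Nat.Properties as ℕP
open import Data.Fin as F using (Fin; toℕ; inject₁; fromℕ; lower₁)
open import Data.Fin.Patterns using (0F; 1F)
open import Data.Fin.Properties as FP
  using (toℕ-injective; toℕ-inject₁; toℕ-fromℕ; toℕ-lower₁; toℕ<n; 1↔⊤; +↔⊎; *↔×; inj⇒≟)
open import Data.Product using (_×_; _,_; proj₁; proj₂)
open import Data.Product.Properties using (≡-dec)
open import Data.Sum using (_⊎_; inj₁; inj₂; swap) renaming (map to ⊎-map)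
open import Data.Unit using (⊤; tt)
open import Data.Empty using (⊥; ⊥-elim)
open import Data.Irrelevant using (Irrelevant; [_])
open import Relation.Nullary using (¬_; Dec; yes; no)
open import Relation.Nullary.Decidable using (recompute)
open import Relation.Unary using (Pred; _∈_)
open import Relation.Binary.PropositionalEquality
open import Relation.Binary.Definitions using (DecidableEquality)
open import Function using (_∘_)
open import Function.Bundles using (_↔_; Inverse; Equivalence; mk↔ₛ′; mk⇔)
open import Function.Properties.Inverse using (↔⇒↣)
open import Function.Construct.Composition using (_↔-∘_)
open import Function.Construct.Symmetry using (↔-sym)
open import Function.Construct.Identity using (↔-id)
open import Data.Sum.Function.Propositional using (_⊎-↔_)
open import Data.Product.Function.NonDependent.Propositional using (_×-↔_)
open import Algebra.Bundles using (Group)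
import Algebra.Properties.Group as GroupProperties

⊎-size : ∀ {a b} {A B : Set} → A HasSize a → B HasSize b → (A ⊎ B) HasSize (a + b)
⊎-size {a} {b} sizeA sizeB = (sizeA ⊎-↔ sizeB) ↔-∘ +↔⊎ {a} {b}

finite-≟ : ∀ {A : Set} {k} → A HasSize k → DecidableEquality A
finite-≟ enumA = inj⇒≟ (↔⇒↣ (↔-sym enumA))

Elems-≡ : {A : Set} {P : Pred A 0ℓ} {a b : Elems P} → proj₁ a ≡ proj₁ b → a ≡ b
Elems-≡ {a = a , [ _ ]} {b = .a , [ _ ]} refl = refl

asGroup : FiniteGroup → Group 0ℓ 0ℓ
asGroup G = record { FiniteGroup G }

module _ {Γ : Graph} where

  unapp : Aut Γ → V Γ → V Γ
  unapp σ = Inverse.from (_≅_.bij σ)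

  app-unapp : (σ : Aut Γ) (v : V Γ) → app σ (unapp σ v) ≡ v
  app-unapp σ v = Inverse.inverseˡ (_≅_.bij σ) refl

  unapp-app : (σ : Aut Γ) (v : V Γ) → unapp σ (app σ v) ≡ v
  unapp-app σ v = Inverse.inverseʳ (_≅_.bij σ) refl

  app-injective : (σ : Aut Γ) {u v : V Γ} → app σ u ≡ app σ v → u ≡ v
  app-injective σ {u} {v} e =
    trans (sym (unapp-app σ u)) (trans (cong (unapp σ) e) (unapp-app σ v))

  app-adj : (σ : Aut Γ) {u v : V Γ} → Adj Γ u v → Adj Γ (app σ u) (app σ v)
  app-adj σ {u} {v} = Equivalence.to (_≅_.pres σ u v)

  app-adj⁻ : (σ : Aut Γ) {u v : V Γ} → Adj Γ (app σ u) (app σ v) → Adj Γ u v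
  app-adj⁻ σ {u} {v} = Equivalence.from (_≅_.pres σ u v)

  _∘ᴬ_ : Aut Γ → Aut Γ → Aut Γ
  σ ∘ᴬ τ = record
    { bij  = _≅_.bij σ ↔-∘ _≅_.bij τ
    ; pres = λ u v → mk⇔ (app-adj σ ∘ app-adj τ) (app-adj⁻ τ ∘ app-adj⁻ σ) }

  _⁻¹ᴬ : Aut Γ → Aut Γ
  σ ⁻¹ᴬ = record
    { bij  = ↔-sym (_≅_.bij σ)
    ; pres = λ u v → mk⇔
        (λ a → app-adj⁻ σ (subst₂ (Adj Γ) (sym (app-unapp σ u)) (sym (app-unapp σ v)) a))
        (λ a → subst₂ (Adj Γ) (app-unapp σ u) (app-unapp σ v) (app-adj σ a)) }

nbhd-≅ : (Γ : Graph) (σ : Aut Γ) {u v : V Γ} → app σ u ≡ v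
  → InducedNbhd Γ u ≅ InducedNbhd Γ v
nbhd-≅ Γ σ {u} refl = record
  { bij = mk↔ₛ′
      (λ { (w , [ p ]) → app σ w , [ app-adj σ p ] })
      (λ { (w , [ q ]) → unapp σ w , [ app-adj⁻ σ (subst (Adj Γ (app σ u)) (sym (app-unapp σ w)) q) ] })
      (λ { (w , [ _ ]) → Elems-≡ (app-unapp σ w) })
      (λ { (w , [ _ ]) → Elems-≡ (unapp-app σ w) })
  ; pres = λ a b → _≅_.pres σ (proj₁ a) (proj₁ b) }

nbhd↔ : (Γ : Graph) (v : V Γ) {A : Set} (enum : A → V Γ)
  (enum-adj : ∀ a → Irrelevant (Adj Γ v (enum a)))
  (label : (w : V Γ) → .(Adj Γ v w) → A)
  (label-enum : ∀ a → .(p : Adj Γ v (enum a)) → label (enum a) p ≡ a)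
  (enum-label : ∀ w → .(p : Adj Γ v w) → enum (label w p) ≡ w)
  → Nbhd Γ v ↔ A
nbhd↔ Γ v {A} enum enum-adj label label-enum enum-label =
  mk↔ₛ′ label′ (λ a → enum a , enum-adj a) (λ a → inverse a (enum-adj a))
        (λ { (w , [ p ]) → Elems-≡ (enum-label w p) })
  where
  label′ : Nbhd Γ v → A
  label′ (w , [ p ]) = label w p
  inverse : ∀ a (q : Irrelevant (Adj Γ v (enum a))) → label′ (enum a , q) ≡ a
  inverse a [ p ] = label-enum a p

module ThetaGraph (G : FiniteGroup) (n : ℕ) (R L S T : Pred (FiniteGroup.Carrier G) 0ℓ)
  (x : FiniteGroup.Carrier G)
  (cayR : IsCayleySubset G R) (cayL : IsCayleySubset G L) (cayT : IsCayleySubset G T) where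

  open FiniteGroup G using (Carrier; order; enum)
  open Group (asGroup G) using (_∙_; _⁻¹; ε; assoc; identityˡ; identityʳ; inverseʳ)
  open GroupProperties (asGroup G)
    using (⁻¹-involutive; ⁻¹-injective; ⁻¹-anti-homo-∙; ⁻¹-anti-homo-//;
           identityˡ-unique; identityʳ-unique;
           //-rightDividesˡ; //-rightDividesʳ; \\-leftDividesˡ; \\-leftDividesʳ)

  -- h (rh)⁻¹ = r⁻¹: the label of a reversed edge lies in the inverse set
  ∙-inverse-of-∙ : ∀ h r → h ∙ (r ∙ h) ⁻¹ ≡ r ⁻¹
  ∙-inverse-of-∙ h r = trans (cong (h ∙_) (⁻¹-anti-homo-∙ r h)) (\\-leftDividesˡ h (r ⁻¹))

  M : ℕ
  M = suc (suc (suc n))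

  Vtx : Set
  Vtx = Carrier × Fin M

  Θ : Graph
  Θ = Theta G M R L S T x

  _≟ⱽ_ : DecidableEquality Vtx
  _≟ⱽ_ = ≡-dec (finite-≟ enum) F._≟_

  pattern upper k = F.suc (F.suc k)

  -- Normal form of the directed edges of Θ: the side conditions on layer
  -- indices are solved, each generating family of edges becomes one
  -- constructor over the layers where it lives.
  data Edge : Vtx → Vtx → Set where
    rEdge : ∀ g r → r ∈ R → Edge (g , 0F) (r ∙ g , 0F)
    lEdge : ∀ g l → l ∈ L → Edge (g , 1F) (l ∙ g , 1F)
    sEdge : ∀ g s → s ∈ S → Edge (g , 0F) (s ∙ g , 1F)
    tEdge : ∀ g t (k : Fin (suc n)) → t ∈ T → Edge (g , upper k) (t ∙ g , upper k)
    pEdge : ∀ g (i : Fin (suc (suc n))) (k : Fin (suc n)) → toℕ i ≡ toℕ k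
            → Edge (g , F.suc i) (g , upper k)
    xEdge : ∀ g (k : Fin (suc n)) → toℕ k ≡ n → Edge (g , 0F) (x ∙ g , upper k)

  toEdge : ∀ {u v} → ThetaEdge G M R L S T x u v → Edge u v
  toEdge (eR g r 0F refl p) = rEdge g r p
  toEdge (eL g l 1F refl p) = lEdge g l p
  toEdge (eS g s 0F 1F refl refl p) = sEdge g s p
  toEdge (eT g t (upper k) (s≤s (s≤s _)) p) = tEdge g t k p
  toEdge (eP g (F.suc i) (upper k) (s≤s _) e) = pEdge g i k (ℕP.suc-injective (ℕP.suc-injective (sym e)))
  toEdge (eP g (F.suc i) 1F (s≤s _) ())
  toEdge (eX g 0F (upper k) refl e) = xEdge g k (ℕP.suc-injective (ℕP.suc-injective (ℕP.suc-injective e)))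
  toEdge (eX g 0F 0F refl ())
  toEdge (eX g 0F 1F refl ())

  fromEdge : ∀ {u v} → Edge u v → ThetaEdge G M R L S T x u v
  fromEdge (rEdge g r p) = eR g r 0F refl p
  fromEdge (lEdge g l p) = eL g l 1F refl p
  fromEdge (sEdge g s p) = eS g s 0F 1F refl refl p
  fromEdge (tEdge g t k p) = eT g t (upper k) (s≤s (s≤s z≤n)) p
  fromEdge (pEdge g i k e) = eP g (F.suc i) (upper k) (s≤s z≤n) (cong (suc ∘ suc) (sym e))
  fromEdge (xEdge g k e) = eX g 0F (upper k) refl (cong (suc ∘ suc ∘ suc) e)

  Adj′ : Vtx → Vtx → Set
  Adj′ u v = Edge u v ⊎ Edge v u

  normal : ∀ {u v} → Adj Θ u v → Adj′ u v
  normal (inj₁ e) = inj₁ (toEdge e)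
  normal (inj₂ e) = inj₂ (toEdge e)

  unnormal : ∀ {u v} → Adj′ u v → Adj Θ u v
  unnormal (inj₁ e) = inj₁ (fromEdge e)
  unnormal (inj₂ e) = inj₂ (fromEdge e)

  finite : IsFinite Θ
  finite = order ℕ.* M , (enum ×-↔ ↔-id (Fin M)) ↔-∘ *↔× {order} {M}

  no-loop : ∀ {u v} → Edge u v → u ≢ v
  no-loop (rEdge g r p) e = proj₁ cayR (subst R (identityˡ-unique r g (sym (cong proj₁ e))) p)
  no-loop (lEdge g l p) e = proj₁ cayL (subst L (identityˡ-unique l g (sym (cong proj₁ e))) p)
  no-loop (tEdge g t k p) e = proj₁ cayT (subst T (identityˡ-unique t g (sym (cong proj₁ e))) p)
  no-loop (sEdge g s p) ()
  no-loop (xEdge g k p) ()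
  no-loop (pEdge g i k q) e with cong proj₂ e
  ... | refl = ℕP.1+n≢n q

  simple : IsSimple Θ
  simple = (λ u v → swap) , λ v a → loop-free (normal a)
    where
    loop-free : ∀ {v} → Adj′ v v → ⊥
    loop-free (inj₁ e) = no-loop e refl
    loop-free (inj₂ e) = no-loop e refl

  infixl 7 _·_
  _·_ : Vtx → Carrier → Vtx
  u · c = (proj₁ u ∙ c , proj₂ u)

  -- edges are given by left multiplication, which commutes with right multiplication
  reassoc : ∀ {u} a g c {j : Fin M} → Edge u (a ∙ (g ∙ c) , j) → Edge u (a ∙ g ∙ c , j)
  reassoc a g c = subst (λ z → Edge _ (z , _)) (sym (assoc a g c))

  ·-edge : ∀ c {u v} → Edge u v → Edge (u · c) (v · c)
  ·-edge c (rEdge g r p) = reassoc r g c (rEdge (g ∙ c) r p)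
  ·-edge c (lEdge g l p) = reassoc l g c (lEdge (g ∙ c) l p)
  ·-edge c (sEdge g s p) = reassoc s g c (sEdge (g ∙ c) s p)
  ·-edge c (tEdge g t k p) = reassoc t g c (tEdge (g ∙ c) t k p)
  ·-edge c (pEdge g i k e) = pEdge (g ∙ c) i k e
  ·-edge c (xEdge g k e) = reassoc x g c (xEdge (g ∙ c) k e)

  ·-adj : ∀ c {u v} → Adj Θ u v → Adj Θ (u · c) (v · c)
  ·-adj c a = unnormal (⊎-map (·-edge c) (·-edge c) (normal a))

  ·-·⁻¹ : ∀ u c → u · c · c ⁻¹ ≡ u
  ·-·⁻¹ u c = cong (_, proj₂ u) (//-rightDividesʳ c (proj₁ u))

  ·⁻¹-· : ∀ u c → u · c ⁻¹ · c ≡ u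
  ·⁻¹-· u c = cong (_, proj₂ u) (//-rightDividesˡ c (proj₁ u))

  rightMul : Carrier → Aut Θ
  rightMul c = record
    { bij  = mk↔ₛ′ (_· c) (_· c ⁻¹) (λ v → ·⁻¹-· v c) (λ v → ·-·⁻¹ v c)
    ; pres = λ u v → mk⇔ (·-adj c)
        (λ a → subst₂ (Adj Θ) (·-·⁻¹ u c) (·-·⁻¹ v c) (·-adj (c ⁻¹) a)) }

  Param₀ : Set
  Param₀ = Elems R ⊎ (Elems S ⊎ ⊤)

  top : Fin M
  top = upper (fromℕ n)

  enum₀ : Carrier → Param₀ → Vtx
  enum₀ g (inj₁ (r , _)) = (r ∙ g , 0F)
  enum₀ g (inj₂ (inj₁ (s , _))) = (s ∙ g , 1F)
  enum₀ g (inj₂ (inj₂ _)) = (x ∙ g , top)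

  enum₀-adj : ∀ g a → Irrelevant (Adj Θ (g , 0F) (enum₀ g a))
  enum₀-adj g (inj₁ (r , [ p ])) = [ unnormal (inj₁ (rEdge g r p)) ]
  enum₀-adj g (inj₂ (inj₁ (s , [ p ]))) = [ unnormal (inj₁ (sEdge g s p)) ]
  enum₀-adj g (inj₂ (inj₂ _)) = [ unnormal (inj₁ (xEdge g (fromℕ n) (toℕ-fromℕ n))) ]

  R-label : ∀ g h → Adj′ (g , 0F) (h , 0F) → h ∙ g ⁻¹ ∈ R
  R-label g _ (inj₁ (rEdge _ r p)) = subst R (sym (//-rightDividesʳ g r)) p
  R-label _ h (inj₂ (rEdge _ r p)) = subst R (sym (∙-inverse-of-∙ h r)) (proj₂ cayR r p)

  S-label₀ : ∀ g h → Adj′ (g , 0F) (h , 1F) → h ∙ g ⁻¹ ∈ S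
  S-label₀ g _ (inj₁ (sEdge _ s p)) = subst S (sym (//-rightDividesʳ g s)) p

  x-neighbour : ∀ g h k → Adj′ (g , 0F) (h , upper k) → (x ∙ g , top) ≡ (h , upper k)
  x-neighbour g _ k (inj₁ (xEdge _ _ e)) =
    cong (λ z → (x ∙ g , upper z)) (toℕ-injective (trans (toℕ-fromℕ n) (sym e)))

  label₀ : ∀ g (w : Vtx) → .(Adj Θ (g , 0F) w) → Param₀
  label₀ g (h , 0F) p = inj₁ (h ∙ g ⁻¹ , [ R-label g h (normal p) ])
  label₀ g (h , 1F) p = inj₂ (inj₁ (h ∙ g ⁻¹ , [ S-label₀ g h (normal p) ]))
  label₀ g (h , upper k) p = inj₂ (inj₂ tt)

  label₀-enum₀ : ∀ g a → .(p : Adj Θ (g , 0F) (enum₀ g a)) → label₀ g (enum₀ g a) p ≡ a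
  label₀-enum₀ g (inj₁ (r , _)) p = cong inj₁ (Elems-≡ (//-rightDividesʳ g r))
  label₀-enum₀ g (inj₂ (inj₁ (s , _))) p = cong (inj₂ ∘ inj₁) (Elems-≡ (//-rightDividesʳ g s))
  label₀-enum₀ g (inj₂ (inj₂ tt)) p = refl

  enum₀-label₀ : ∀ g w → .(p : Adj Θ (g , 0F) w) → enum₀ g (label₀ g w p) ≡ w
  enum₀-label₀ g (h , 0F) p = cong (_, 0F) (//-rightDividesˡ g h)
  enum₀-label₀ g (h , 1F) p = cong (_, 1F) (//-rightDividesˡ g h)
  enum₀-label₀ g (h , upper k) p = recompute (_ ≟ⱽ _) (x-neighbour g h k (normal p))

  nbhd₀ : ∀ g → Nbhd Θ (g , 0F) ↔ Param₀
  nbhd₀ g = nbhd↔ Θ _ (enum₀ g) (enum₀-adj g) (label₀ g) (label₀-enum₀ g) (enum₀-label₀ g)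

  Param₁ : Set
  Param₁ = Elems L ⊎ (Elems S ⊎ ⊤)

  enum₁ : Carrier → Param₁ → Vtx
  enum₁ g (inj₁ (l , _)) = (l ∙ g , 1F)
  enum₁ g (inj₂ (inj₁ (s , _))) = (s ⁻¹ ∙ g , 0F)
  enum₁ g (inj₂ (inj₂ _)) = (g , upper 0F)

  enum₁-adj : ∀ g a → Irrelevant (Adj Θ (g , 1F) (enum₁ g a))
  enum₁-adj g (inj₁ (l , [ p ])) = [ unnormal (inj₁ (lEdge g l p)) ]
  enum₁-adj g (inj₂ (inj₁ (s , [ p ]))) =
    [ unnormal (inj₂ (subst (λ z → Edge (s ⁻¹ ∙ g , 0F) (z , 1F)) (\\-leftDividesˡ s g) (sEdge (s ⁻¹ ∙ g) s p))) ]
  enum₁-adj g (inj₂ (inj₂ _)) = [ unnormal (inj₁ (pEdge g 0F 0F refl)) ]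

  L-label : ∀ g h → Adj′ (g , 1F) (h , 1F) → h ∙ g ⁻¹ ∈ L
  L-label g _ (inj₁ (lEdge _ l p)) = subst L (sym (//-rightDividesʳ g l)) p
  L-label _ h (inj₂ (lEdge _ l p)) = subst L (sym (∙-inverse-of-∙ h l)) (proj₂ cayL l p)

  S-label₁ : ∀ g h → Adj′ (g , 1F) (h , 0F) → g ∙ h ⁻¹ ∈ S
  S-label₁ _ h (inj₂ (sEdge _ s p)) = subst S (sym (//-rightDividesʳ h s)) p

  up-neighbour₁ : ∀ g h k → Adj′ (g , 1F) (h , upper k) → (g , upper 0F) ≡ (h , upper k)
  up-neighbour₁ g _ k (inj₁ (pEdge _ 0F _ e)) = cong (λ z → (g , upper z)) (toℕ-injective e)

  label₁ : ∀ g (w : Vtx) → .(Adj Θ (g , 1F) w) → Param₁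
  label₁ g (h , 0F) p = inj₂ (inj₁ (g ∙ h ⁻¹ , [ S-label₁ g h (normal p) ]))
  label₁ g (h , 1F) p = inj₁ (h ∙ g ⁻¹ , [ L-label g h (normal p) ])
  label₁ g (h , upper k) p = inj₂ (inj₂ tt)

  label₁-enum₁ : ∀ g a → .(p : Adj Θ (g , 1F) (enum₁ g a)) → label₁ g (enum₁ g a) p ≡ a
  label₁-enum₁ g (inj₁ (l , _)) p = cong inj₁ (Elems-≡ (//-rightDividesʳ g l))
  label₁-enum₁ g (inj₂ (inj₁ (s , _))) p =
    cong (inj₂ ∘ inj₁) (Elems-≡ (trans (∙-inverse-of-∙ g (s ⁻¹)) (⁻¹-involutive s)))
  label₁-enum₁ g (inj₂ (inj₂ tt)) p = refl

  enum₁-label₁ : ∀ g w → .(p : Adj Θ (g , 1F) w) → enum₁ g (label₁ g w p) ≡ w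
  enum₁-label₁ g (h , 0F) p = cong (_, 0F) (trans (cong (_∙ g) (⁻¹-anti-homo-// g h)) (//-rightDividesˡ g h))
  enum₁-label₁ g (h , 1F) p = cong (_, 1F) (//-rightDividesˡ g h)
  enum₁-label₁ g (h , upper k) p = recompute (_ ≟ⱽ _) (up-neighbour₁ g h k (normal p))

  nbhd₁ : ∀ g → Nbhd Θ (g , 1F) ↔ Param₁
  nbhd₁ g = nbhd↔ Θ _ (enum₁ g) (enum₁-adj g) (label₁ g) (label₁-enum₁ g) (enum₁-label₁ g)

  Param₂ : Set
  Param₂ = Elems T ⊎ (⊤ ⊎ ⊤)

  below : Carrier → Fin (suc n) → Vtx
  below g k = (g , F.suc (inject₁ k))

  above′ : ∀ {k : Fin (suc n)} → Dec (n ≡ toℕ k) → Carrier → Vtx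
  above′ (yes _) g = (x ⁻¹ ∙ g , 0F)
  above′ {k} (no k≢n) g = (g , upper (F.suc (lower₁ k k≢n)))

  above : Fin (suc n) → Carrier → Vtx
  above k g = above′ (n ℕ.≟ toℕ k) g

  enum₂ : Carrier → Fin (suc n) → Param₂ → Vtx
  enum₂ g k (inj₁ (t , _)) = (t ∙ g , upper k)
  enum₂ g k (inj₂ (inj₁ _)) = below g k
  enum₂ g k (inj₂ (inj₂ _)) = above k g

  above′-adj : ∀ g k (top? : Dec (n ≡ toℕ k)) → Adj′ (g , upper k) (above′ top? g)
  above′-adj g k (yes e) = inj₂ (subst (λ z → Edge (x ⁻¹ ∙ g , 0F) (z , upper k)) (\\-leftDividesˡ x g) (xEdge (x ⁻¹ ∙ g) k (sym e)))
  above′-adj g k (no k≢n) = inj₁ (pEdge g (F.suc k) (F.suc (lower₁ k k≢n)) (cong suc (sym (toℕ-lower₁ k k≢n))))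

  enum₂-adj : ∀ g k a → Irrelevant (Adj Θ (g , upper k) (enum₂ g k a))
  enum₂-adj g k (inj₁ (t , [ p ])) = [ unnormal (inj₁ (tEdge g t k p)) ]
  enum₂-adj g k (inj₂ (inj₁ _)) = [ unnormal (inj₂ (pEdge g (inject₁ k) k (toℕ-inject₁ k))) ]
  enum₂-adj g k (inj₂ (inj₂ _)) = [ unnormal (above′-adj g k (n ℕ.≟ toℕ k)) ]

  T-label : ∀ g k h → Adj′ (g , upper k) (h , upper k) → h ∙ g ⁻¹ ∈ T
  T-label g k _ (inj₁ (tEdge _ t _ p)) = subst T (sym (//-rightDividesʳ g t)) p
  T-label g k _ (inj₁ (pEdge _ _ _ e)) = ⊥-elim (ℕP.1+n≢n e)
  T-label _ k h (inj₂ (tEdge _ t _ p)) = subst T (sym (∙-inverse-of-∙ h t)) (proj₂ cayT t p)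
  T-label _ k h (inj₂ (pEdge _ _ _ e)) = ⊥-elim (ℕP.1+n≢n e)

  label₂′ : ∀ g k (w : Vtx) → .(Adj Θ (g , upper k) w)
    → Dec (proj₂ w ≡ upper k) → Dec (w ≡ below g k) → Param₂
  label₂′ g k (h , j) p (yes e) _ =
    inj₁ (h ∙ g ⁻¹ , [ T-label g k h (normal (subst (λ z → Adj Θ (g , upper k) (h , z)) e p)) ])
  label₂′ g k w p (no _) (yes _) = inj₂ (inj₁ tt)
  label₂′ g k w p (no _) (no _) = inj₂ (inj₂ tt)

  label₂ : ∀ g k (w : Vtx) → .(Adj Θ (g , upper k) w) → Param₂
  label₂ g k w p = label₂′ g k w p (proj₂ w F.≟ upper k) (w ≟ⱽ below g k)

  below-layer : ∀ k → _≢_ {A = Fin M} (F.suc (inject₁ k)) (upper k)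
  below-layer k e = ℕP.1+n≢n (sym (trans (sym (toℕ-inject₁ k)) (cong toℕ (FP.suc-injective e))))

  above′-layer : ∀ g k (top? : Dec (n ≡ toℕ k)) → proj₂ (above′ top? g) ≢ upper k
  above′-layer g k (yes _) ()
  above′-layer g k (no k≢n) e =
    ℕP.1+n≢n (trans (cong suc (sym (toℕ-lower₁ k k≢n))) (cong toℕ (FP.suc-injective (FP.suc-injective e))))

  above′≢below : ∀ g k (top? : Dec (n ≡ toℕ k)) → above′ top? g ≢ below g k
  above′≢below g k (yes _) ()
  above′≢below g k (no k≢n) e = ℕP.>⇒≢ (ℕP.m<n+m (toℕ k) {2} (s≤s z≤n))
    (trans (cong (suc ∘ suc) (sym (toℕ-lower₁ k k≢n)))
      (trans (cong toℕ (FP.suc-injective (cong proj₂ e))) (toℕ-inject₁ k)))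

  label₂′-enum₂ : ∀ g k a → .(p : Adj Θ (g , upper k) (enum₂ g k a))
    (same? : Dec (proj₂ (enum₂ g k a) ≡ upper k)) (below? : Dec (enum₂ g k a ≡ below g k))
    → label₂′ g k (enum₂ g k a) p same? below? ≡ a
  label₂′-enum₂ g k (inj₁ (t , _)) p (yes _) _ = cong inj₁ (Elems-≡ (//-rightDividesʳ g t))
  label₂′-enum₂ g k (inj₁ _) p (no ≢) _ = ⊥-elim (≢ refl)
  label₂′-enum₂ g k (inj₂ (inj₁ _)) p (yes e) _ = ⊥-elim (below-layer k e)
  label₂′-enum₂ g k (inj₂ (inj₁ _)) p (no _) (yes _) = refl
  label₂′-enum₂ g k (inj₂ (inj₁ _)) p (no _) (no ≢) = ⊥-elim (≢ refl)
  label₂′-enum₂ g k (inj₂ (inj₂ _)) p (yes e) _ = ⊥-elim (above′-layer g k (n ℕ.≟ toℕ k) e)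
  label₂′-enum₂ g k (inj₂ (inj₂ _)) p (no _) (yes e) = ⊥-elim (above′≢below g k (n ℕ.≟ toℕ k) e)
  label₂′-enum₂ g k (inj₂ (inj₂ tt)) p (no _) (no _) = refl

  other-neighbour : ∀ g k w → proj₂ w ≢ upper k → w ≢ below g k
    → (top? : Dec (n ≡ toℕ k)) → Adj′ (g , upper k) w → above′ top? g ≡ w
  other-neighbour g k _ ≢layer ≢below top? (inj₁ (tEdge _ t _ p)) = ⊥-elim (≢layer refl)
  other-neighbour g k _ ≢layer ≢below (yes n≡k) (inj₁ (pEdge _ _ k′ e)) =
    ⊥-elim (ℕP.<-irrefl (sym n≡k) (ℕP.≤-pred (subst (_< suc n) (sym e) (toℕ<n k′))))
  other-neighbour g k _ ≢layer ≢below (no k≢n) (inj₁ (pEdge _ _ k′ e)) =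
    cong (λ z → (g , upper z)) (toℕ-injective (trans (cong suc (toℕ-lower₁ k k≢n)) e))
  other-neighbour g k _ ≢layer ≢below top? (inj₂ (tEdge _ t _ p)) = ⊥-elim (≢layer refl)
  other-neighbour g k _ ≢layer ≢below top? (inj₂ (pEdge _ i _ e)) =
    ⊥-elim (≢below (cong (λ z → (g , F.suc z)) (toℕ-injective (trans e (sym (toℕ-inject₁ k))))))
  other-neighbour _ k _ ≢layer ≢below (yes _) (inj₂ (xEdge h _ e)) = cong (_, 0F) (\\-leftDividesʳ x h)
  other-neighbour _ k _ ≢layer ≢below (no k≢n) (inj₂ (xEdge h _ e)) = ⊥-elim (k≢n (sym e))

  enum₂-label₂′ : ∀ g k w → .(p : Adj Θ (g , upper k) w)
    (same? : Dec (proj₂ w ≡ upper k)) (below? : Dec (w ≡ below g k))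
    → enum₂ g k (label₂′ g k w p same? below?) ≡ w
  enum₂-label₂′ g k (h , j) p (yes e) _ = cong₂ _,_ (//-rightDividesˡ g h) (sym e)
  enum₂-label₂′ g k w p (no _) (yes e) = sym e
  enum₂-label₂′ g k w p (no ≢layer) (no ≢below) =
    recompute (_ ≟ⱽ _) (other-neighbour g k w ≢layer ≢below (n ℕ.≟ toℕ k) (normal p))

  nbhd₂ : ∀ g k → Nbhd Θ (g , upper k) ↔ Param₂
  nbhd₂ g k = nbhd↔ Θ _ (enum₂ g k) (enum₂-adj g k) (label₂ g k)
    (λ a p → label₂′-enum₂ g k a p (proj₂ (enum₂ g k a) F.≟ upper k) (enum₂ g k a ≟ⱽ below g k))
    (λ w p → enum₂-label₂′ g k w p (proj₂ w F.≟ upper k) (w ≟ⱽ below g k))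

  regular : (r l s t : ℕ) → Elems R HasSize r → Elems L HasSize l → Elems S HasSize s
    → Elems T HasSize t → r ≡ l → r + s ≡ t + 1 → IsRegular Θ
  regular r .r s t sizeR sizeL sizeS sizeT refl r+s≡t+1 = t + 2 , valency
    where
    open ≡-Reasoning
    r+[s+1]≡t+2 : r + (s + 1) ≡ t + 2
    r+[s+1]≡t+2 = begin
      r + (s + 1)  ≡⟨ ℕP.+-assoc r s 1 ⟨
      r + s + 1    ≡⟨ cong (_+ 1) r+s≡t+1 ⟩
      t + 1 + 1    ≡⟨ ℕP.+-assoc t 1 1 ⟩
      t + 2        ∎
    valency : ∀ v → Nbhd Θ v HasSize (t + 2)
    valency (g , 0F) = ↔-sym (nbhd₀ g)
      ↔-∘ subst (λ k → Fin k ↔ Param₀) r+[s+1]≡t+2 (⊎-size sizeR (⊎-size sizeS 1↔⊤))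
    valency (g , 1F) = ↔-sym (nbhd₁ g)
      ↔-∘ subst (λ k → Fin k ↔ Param₁) r+[s+1]≡t+2 (⊎-size sizeL (⊎-size sizeS 1↔⊤))
    valency (g , upper k) = ↔-sym (nbhd₂ g k) ↔-∘ ⊎-size sizeT (⊎-size 1↔⊤ 1↔⊤)

  module Automorphisms (biCayGRR : IsGRR 2 G (BiCay G R L S))
    (distinct-nbhds : ∀ (i : Fin M) → 2 ≤ toℕ i
        → ¬ (InducedNbhd Θ (ε , 0F) ≅ InducedNbhd Θ (ε , i))
          × ¬ (InducedNbhd Θ (ε , 1F) ≅ InducedNbhd Θ (ε , i))) where

    B : Graph
    B = BiCay G R L S

    open IsGRR biCayGRR using ()
      renaming (semireg to B-semireg; orbit to B-orbit; orbit-surj to B-orbit-surj; orbit-iff to B-orbit-iff)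

    data Bottom : Fin M → Set where
      bottom₀ : Bottom 0F
      bottom₁ : Bottom 1F

    -- τ maps 1_0 and 1_1 into the bottom layers: otherwise, composing with a
    -- right multiplication, it would carry 1_0 or 1_1 to some 1_{k+2} and
    -- identify their induced neighbourhoods
    bottom-at-ε : (τ : Aut Θ) {b : Fin M} → Bottom b → Bottom (proj₂ (app τ (ε , b)))
    bottom-at-ε τ {b} bb with app τ (ε , b) in eq
    ... | (h , 0F) = bottom₀
    ... | (h , 1F) = bottom₁
    ... | (h , upper k) = ⊥-elim (differs bb (nbhd-≅ Θ (rightMul (h ⁻¹) ∘ᴬ τ) moved))
      where
      moved : app (rightMul (h ⁻¹) ∘ᴬ τ) (ε , b) ≡ (ε , upper k)
      moved = trans (cong (_· h ⁻¹) eq) (cong (_, upper k) (inverseʳ h))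
      differs : ∀ {b} → Bottom b → ¬ (InducedNbhd Θ (ε , b) ≅ InducedNbhd Θ (ε , upper k))
      differs bottom₀ = proj₁ (distinct-nbhds (upper k) (s≤s (s≤s z≤n)))
      differs bottom₁ = proj₂ (distinct-nbhds (upper k) (s≤s (s≤s z≤n)))

    bottom-preserved : (τ : Aut Θ) (g : Carrier) {b : Fin M} → Bottom b → Bottom (proj₂ (app τ (g , b)))
    bottom-preserved τ g {b} bb =
      subst (λ z → Bottom (proj₂ (app τ (z , b)))) (identityˡ g) (bottom-at-ε (τ ∘ᴬ rightMul g) bb)

    emb : Fin 2 → Fin M
    emb 0F = 0F
    emb 1F = 1F

    ↑ : Carrier × Fin 2 → Vtx
    ↑ (g , b) = (g , emb b)

    ↓ : Vtx → Carrier × Fin 2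
    ↓ (g , 0F) = (g , 0F)
    ↓ (g , F.suc _) = (g , 1F)

    ↓↑ : ∀ w → ↓ (↑ w) ≡ w
    ↓↑ (g , 0F) = refl
    ↓↑ (g , 1F) = refl

    ↑↓ : ∀ u → Bottom (proj₂ u) → ↑ (↓ u) ≡ u
    ↑↓ (g , .0F) bottom₀ = refl
    ↑↓ (g , .1F) bottom₁ = refl

    emb-bottom : ∀ b → Bottom (emb b)
    emb-bottom 0F = bottom₀
    emb-bottom 1F = bottom₁

    stays-bottom : (τ : Aut Θ) → ∀ w → ↑ (↓ (app τ (↑ w))) ≡ app τ (↑ w)
    stays-bottom τ (g , b) = ↑↓ _ (bottom-preserved τ g (emb-bottom b))

    ↑-edge : ∀ {u v} → BiCayEdge G R L S u v → Edge (↑ u) (↑ v)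
    ↑-edge (eR g r p) = rEdge g r p
    ↑-edge (eL g l p) = lEdge g l p
    ↑-edge (eS g s p) = sEdge g s p

    ↓-edge : ∀ u v → Edge (↑ u) (↑ v) → BiCayEdge G R L S u v
    ↓-edge (g , 0F) (_ , 0F) (rEdge _ r p) = eR g r p
    ↓-edge (g , 0F) (_ , 1F) (sEdge _ s p) = eS g s p
    ↓-edge (g , 1F) (_ , 1F) (lEdge _ l p) = eL g l p
    ↓-edge (g , 1F) (_ , 0F) ()

    ↑-adj : ∀ u v → Adj B u v → Adj Θ (↑ u) (↑ v)
    ↑-adj u v (inj₁ e) = inj₁ (fromEdge (↑-edge e))
    ↑-adj u v (inj₂ e) = inj₂ (fromEdge (↑-edge e))

    ↑-adj⁻ : ∀ u v → Adj Θ (↑ u) (↑ v) → Adj B u v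
    ↑-adj⁻ u v (inj₁ e) = inj₁ (↓-edge u v (toEdge e))
    ↑-adj⁻ u v (inj₂ e) = inj₂ (↓-edge v u (toEdge e))

    restrict : Aut Θ → Aut B
    restrict τ = record
      { bij = mk↔ₛ′ (λ w → ↓ (app τ (↑ w))) (λ w → ↓ (unapp τ (↑ w)))
          (λ w → trans (cong (↓ ∘ app τ) (stays-bottom (τ ⁻¹ᴬ) w))
                   (trans (cong ↓ (app-unapp τ (↑ w))) (↓↑ w)))
          (λ w → trans (cong (↓ ∘ unapp τ) (stays-bottom τ w))
                   (trans (cong ↓ (unapp-app τ (↑ w))) (↓↑ w)))
      ; pres = λ u v → mk⇔
          (λ a → ↑-adj⁻ _ _ (subst₂ (Adj Θ) (sym (stays-bottom τ u)) (sym (stays-bottom τ v))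
                   (app-adj τ (↑-adj u v a))))
          (λ a → ↑-adj⁻ u v (app-adj⁻ τ (subst₂ (Adj Θ) (stays-bottom τ u) (stays-bottom τ v)
                   (↑-adj _ _ a)))) }

    -- if τ carried 1_0 to some h_1, every vertex of BiCay would lie in the
    -- orbit of 1_0 (layer 0 by right multiplication, layer 1 via τ), but
    -- BiCay has two orbits
    single-orbit : (τ : Aut Θ) (h : Carrier) → app τ (ε , 0F) ≡ (h , 1F)
      → ∀ w → B-orbit w ≡ B-orbit (ε , 0F)
    single-orbit τ h eq (g , 0F) = sym (Equivalence.from (B-orbit-iff (ε , 0F) (g , 0F))
      (restrict (rightMul g) , cong (_, 0F) (identityˡ g)))
    single-orbit τ h eq (g , 1F) = sym (Equivalence.from (B-orbit-iff (ε , 0F) (g , 1F))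
      (restrict (rightMul (h ⁻¹ ∙ g) ∘ᴬ τ) ,
       cong ↓ (trans (cong (_· (h ⁻¹ ∙ g)) eq) (cong (_, 1F) (\\-leftDividesˡ h g)))))

    two-orbits : ¬ (∀ w → B-orbit w ≡ B-orbit (ε , 0F))
    two-orbits same with B-orbit-surj 0F | B-orbit-surj 1F
    ... | (u , u↦0) | (v , v↦1) with trans (sym u↦0) (trans (same u) (trans (sym (same v)) v↦1))
    ... | ()

    layer₀-preserved : (τ : Aut Θ) → proj₂ (app τ (ε , 0F)) ≡ 0F
    layer₀-preserved τ with app τ (ε , 0F) in eq | bottom-at-ε τ bottom₀
    ... | (h , 0F) | _ = refl
    ... | (h , 1F) | _ = ⊥-elim (two-orbits (single-orbit τ h eq))

    -- an automorphism fixing 1_0 fixes the bottom layers pointwise, since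
    -- its restriction to the semiregular BiCay fixes a vertex
    fixes-bottom : (τ : Aut Θ) → app τ (ε , 0F) ≡ (ε , 0F) → ∀ w → app τ (↑ w) ≡ ↑ w
    fixes-bottom τ fix w =
      trans (sym (stays-bottom τ w)) (cong ↑ (B-semireg (restrict τ) (ε , 0F) (cong ↓ fix) w))

    FixedUpTo : Aut Θ → ℕ → Set
    FixedUpTo τ k = ∀ g (j : Fin M) → toℕ j ≤ k → app τ (g , j) ≡ (g , j)

    upper-neighbour : ∀ g i w → Adj′ (g , F.suc i) w → suc (toℕ i) < toℕ (proj₂ w)
      → proj₁ w ≡ g × toℕ (proj₂ w) ≡ suc (suc (toℕ i))
    upper-neighbour g _ _ (inj₁ (lEdge _ l p)) (s≤s ())
    upper-neighbour g _ _ (inj₁ (tEdge _ t k p)) lt = ⊥-elim (ℕP.<-irrefl refl lt)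
    upper-neighbour g _ _ (inj₁ (pEdge _ i k e)) lt = refl , cong (suc ∘ suc) (sym e)
    upper-neighbour _ _ _ (inj₂ (lEdge h l p)) (s≤s ())
    upper-neighbour _ _ _ (inj₂ (sEdge h s p)) ()
    upper-neighbour _ _ _ (inj₂ (tEdge h t k p)) lt = ⊥-elim (ℕP.<-irrefl refl lt)
    upper-neighbour _ _ _ (inj₂ (pEdge h i k e)) lt =
      ⊥-elim (ℕP.<-irrefl refl (ℕP.<-trans (ℕP.n<1+n _) (subst (λ z → suc (suc (toℕ k)) < suc z) e lt)))
    upper-neighbour _ _ _ (inj₂ (xEdge h k e)) ()

    -- If τ fixes the layers ≤ k + 1 then it fixes g_{k+2}: τ(g_{k+2}) is a
    -- neighbour of τ(g_{k+1}) = g_{k+1}, not in a lower layer (those are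
    -- fixed and τ is injective), hence it is g_{k+2}.
    climb : (τ : Aut Θ) (k : ℕ) → FixedUpTo τ (suc k)
      → ∀ g (k′ : Fin (suc n)) → toℕ k′ ≡ k → app τ (g , upper k′) ≡ (g , upper k′)
    climb τ k fixed g k′ k′≡k =
      cong₂ _,_ (proj₁ image) (toℕ-injective (trans (proj₂ image) (cong (suc ∘ suc) (toℕ-inject₁ k′))))
      where
      w = app τ (g , upper k′)
      inject₁k′≡k : toℕ (inject₁ k′) ≡ k
      inject₁k′≡k = trans (toℕ-inject₁ k′) k′≡k
      below-fixed : app τ (below g k′) ≡ below g k′
      below-fixed = fixed g (F.suc (inject₁ k′)) (s≤s (ℕP.≤-reflexive inject₁k′≡k))
      adjacent : Adj′ (below g k′) w
      adjacent = normal (subst (λ z → Adj Θ z w) below-fixed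
        (app-adj τ (unnormal (inj₁ (pEdge g (inject₁ k′) k′ (toℕ-inject₁ k′))))))
      higher : suc (toℕ (inject₁ k′)) < toℕ (proj₂ w)
      higher with toℕ (proj₂ w) ℕ.≤? suc k
      ... | yes low = ⊥-elim (ℕP.<-irrefl refl
              (subst (_≤ suc k) (trans (cong (toℕ ∘ proj₂) w-fixed) (cong (suc ∘ suc) k′≡k)) low))
        where
        w-fixed : w ≡ (g , upper k′)
        w-fixed = app-injective τ (fixed (proj₁ w) (proj₂ w) low)
      ... | no high = subst (_< toℕ (proj₂ w)) (cong suc (sym inject₁k′≡k)) (ℕP.≰⇒> high)
      image = upper-neighbour g (inject₁ k′) w adjacent higher

    fixed-up-to : (τ : Aut Θ) → FixedUpTo τ 1 → ∀ k → FixedUpTo τ (suc k)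
    fixed-up-to τ base zero = base
    fixed-up-to τ base (suc k) g j j≤k+2 with toℕ j ℕ.≤? suc k
    ... | yes j≤k+1 = fixed-up-to τ base k g j j≤k+1
    ... | no j≰k+1 = new-layer j j≤k+2 j≰k+1
      where
      new-layer : ∀ j → toℕ j ≤ suc (suc k) → ¬ (toℕ j ≤ suc k) → app τ (g , j) ≡ (g , j)
      new-layer 0F _ ≰ = ⊥-elim (≰ z≤n)
      new-layer 1F _ ≰ = ⊥-elim (≰ (s≤s z≤n))
      new-layer (upper k′) ≤ ≰ = climb τ k (fixed-up-to τ base k) g k′
        (ℕP.≤-antisym (ℕP.≤-pred (ℕP.≤-pred ≤)) (ℕP.≤-pred (ℕP.≤-pred (ℕP.≰⇒> ≰))))

    fixed-bottom : (τ : Aut Θ) → (∀ w → app τ (↑ w) ≡ ↑ w) → FixedUpTo τ 1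
    fixed-bottom τ fix g 0F _ = fix (g , 0F)
    fixed-bottom τ fix g 1F _ = fix (g , 1F)
    fixed-bottom τ fix g (upper _) (s≤s ())

    -- Every automorphism σ is right multiplication by h, where σ(1_0) = h_0:
    -- the automorphism σ followed by right multiplication by h⁻¹ fixes 1_0,
    -- hence the bottom layers, hence everything.
    is-rightMul : (σ : Aut Θ) → ∀ v → app σ v ≡ v · proj₁ (app σ (ε , 0F))
    is-rightMul σ v = trans (sym (·⁻¹-· (app σ v) h)) (cong (_· h) (fixes-all v))
      where
      h = proj₁ (app σ (ε , 0F))
      τ = rightMul (h ⁻¹) ∘ᴬ σ
      fixes-ε : app τ (ε , 0F) ≡ (ε , 0F)
      fixes-ε = cong₂ _,_ (inverseʳ h) (layer₀-preserved σ)
      fixes-all : ∀ w → app τ w ≡ w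
      fixes-all (g , j) =
        fixed-up-to τ (fixed-bottom τ (fixes-bottom τ fixes-ε)) (suc n) g j (ℕP.≤-pred (toℕ<n j))

    semiregular : (σ : Aut Θ) (v : Vtx) → app σ v ≡ v → ∀ w → app σ w ≡ w
    semiregular σ v fix w = begin
      app σ w       ≡⟨ is-rightMul σ w ⟩
      w · h         ≡⟨ cong (λ c → (proj₁ w ∙ c , proj₂ w)) h≡ε ⟩
      w · ε         ≡⟨ cong (_, proj₂ w) (identityʳ (proj₁ w)) ⟩
      w             ∎
      where
      open ≡-Reasoning
      h = proj₁ (app σ (ε , 0F))
      h≡ε : h ≡ ε
      h≡ε = identityʳ-unique (proj₁ v) h (cong proj₁ (trans (sym (is-rightMul σ v)) fix))

    grr : (r l s t : ℕ) → Elems R HasSize r → Elems L HasSize l → Elems S HasSize s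
      → Elems T HasSize t → r ≡ l → r + s ≡ t + 1 → IsGRR M G Θ
    grr r l s t sizeR sizeL sizeS sizeT r≡l r+s≡t+1 = record
      { finite     = finite
      ; simple     = simple
      ; regular    = regular r l s t sizeR sizeL sizeS sizeT r≡l r+s≡t+1
      ; φ          = λ g → rightMul (g ⁻¹)
      ; φ-hom      = λ g h v → cong (_, proj₂ v)
          (trans (cong (proj₁ v ∙_) (⁻¹-anti-homo-∙ g h)) (sym (assoc (proj₁ v) (h ⁻¹) (g ⁻¹))))
      ; φ-inj      = λ g h same → ⁻¹-injective
          (trans (sym (identityˡ (g ⁻¹))) (trans (cong proj₁ (same (ε , 0F))) (identityˡ (h ⁻¹))))
      ; φ-surj     = λ σ → proj₁ (app σ (ε , 0F)) ⁻¹ , λ v →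
          trans (cong (v ·_) (⁻¹-involutive _)) (sym (is-rightMul σ v))
      ; semireg    = semiregular
      ; orbit      = proj₂
      ; orbit-surj = λ i → (ε , i) , refl
      ; orbit-iff  = λ u v → mk⇔
          (λ same-layer → rightMul (proj₁ u ⁻¹ ∙ proj₁ v) ,
                          cong₂ _,_ (\\-leftDividesˡ (proj₁ u) (proj₁ v)) same-layer)
          (λ { (σ , σu≡v) → trans (sym (cong proj₂ (is-rightMul σ u))) (cong proj₂ σu≡v) })
      }

lemma4p2 : (G : FiniteGroup) (m : ℕ) (m≥3 : 3 ≤ m)
  (R L S T : Pred (FiniteGroup.Carrier G) 0ℓ) (x : FiniteGroup.Carrier G)
  → IsCayleySubset G R → IsCayleySubset G L → IsCayleySubset G T
  → (r l s t : ℕ) → Elems R HasSize r → Elems L HasSize l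
  → Elems S HasSize s → Elems T HasSize t
  → r ≡ l → r + s ≡ t + 1
  → ¬ (x ∈ S)
  → IsGRR 2 G (BiCay G R L S)
  → (∀ (i : Fin m) → 2 ≤ toℕ i
      → ¬ (InducedNbhd (Theta G m R L S T x) (FiniteGroup.ε G , fin0 m≥3)
             ≅ InducedNbhd (Theta G m R L S T x) (FiniteGroup.ε G , i))
        × ¬ (InducedNbhd (Theta G m R L S T x) (FiniteGroup.ε G , fin1 m≥3)
             ≅ InducedNbhd (Theta G m R L S T x) (FiniteGroup.ε G , i)))
  → IsGRR m G (Theta G m R L S T x)
lemma4p2 G .(suc (suc (suc n))) (s≤s (s≤s (s≤s {n = n} z≤n))) R L S T x cayR cayL cayT
  r l s t sizeR sizeL sizeS sizeT r≡l r+s≡t+1 _ biCayGRR distinct-nbhds =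
  Automorphisms.grr biCayGRR distinct-nbhds r l s t sizeR sizeL sizeS sizeT r≡l r+s≡t+1
  where open ThetaGraph G n R L S T x cayR cayL cayT
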